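{- Let $W(k)\subseteq[n]^k$, let $\mathcal C\subseteq\mathbb F_2^n$ be a linear $\eta_0$-balanced code, let $\mathcal C'=\operatorname{dsum}_{W(k)}(\mathcal C)$ be an $\eta$-balanced code, and let $\tilde y\in\mathbb F_2^{W(k)}$. Define $$\mathcal L(\tilde y,\mathcal C,\mathcal C')=\{(z,\operatorname{dsum}_{W(k)}(z)) : z\in\mathcal C,\ \Delta(\operatorname{dsum}_{W(k)}(z),\tilde y)\le 1/2-\sqrt\eta\}.$$ Suppose $\mathcal L'$ is a $\zeta$-cover of $\mathcal L(\tilde y,\mathcal C,\mathcal C')$ for some $\zeta<1/2$, and that $\Delta(y',\tilde y)\le 1/2-\sqrt\eta$ for every $(z',y')\in\mathcal L'$. If $W(k)$ is a $(1-2\zeta,\eta)$-parity sampler, then there exists $\mathcal L''\subseteq\mathcal L'$ with $|\mathcal L''|\le 1/\eta$ which is a $(2\zeta)$-cover of $\mathcal L(\tilde y,\mathcal C,\mathcal C')$.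
   Context: $\Delta$ is relative Hamming distance; $\mathrm{bias}(z)=|\mathbb E_i(-1)^{z_i}|$; a linear code is $\varepsilon$-balanced if every nonzero codeword has bias at most $\varepsilon$. Direct sum lifting: for a multiset $W(k)\subseteq[n]^k$ and $z\in\mathbb F_2^n$, $\operatorname{dsum}_{W(k)}(z)=y\in\mathbb F_2^{W(k)}$ with $y_w=\sum_j z_{w_j}$. $W(k)$ is an $(\varepsilon_0,\varepsilon)$-parity sampler if for all $z\in\mathbb F_2^n$ with $\mathrm{bias}(z)\le\varepsilon_0$ one has $\mathrm{bias}(\operatorname{dsum}_{W(k)}(z))\le\varepsilon$. For $A\subseteq\mathcal C$ and $\mathcal L=\{(z,\operatorname{dsum}_{W(k)}(z)):z\in A\}$, a set $\mathcal L'=\{(z^{(j)},\operatorname{dsum}_{W(k)}(z^{(j)}))\}_{j=1}^m$ (with $z^{(j)}\in\mathbb F_2^n$) is a $\zeta$-cover of $\mathcal L$ if for every $(z,y)\in\mathcal L$ there exists $(z',y')\in\mathcal L'$ with $\mathrm{bias}(z-z')>1-2\zeta$.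
   Formalization: The parameters η₀, η and ζ range over the rationals. -}

module Defs where

open import Data.Bool using (Bool; true; false; if_then_else_; _xor_)
open import Data.Nat as ℕ using (ℕ; NonZero)
open import Data.Integer as ℤ using (ℤ; +_)
open import Data.Fin using (Fin)
open import Data.Fin.Subset using (Subset; _∈_)
open import Data.List using (List; map; foldr)
open import Data.List.Base using (allFin)
open import Data.Rational using (ℚ; _≤_; _<_; _-_; _*_; ½; 0ℚ; 1ℚ)
open import Data.Rational as Q using ()
open import Data.Product using (Σ; _×_; ∃)
open import Relation.Binary.PropositionalEquality using (_≡_)
open import Relation.Nullary using (¬_)

-- vectors of 𝔽₂ⁿ, represented as functions Fin n → Bool (true = 1)
𝔽₂^ : ℕ → Set
𝔽₂^ n = Fin n → Bool

Σℤ : (n : ℕ) → (Fin n → ℤ) → ℤ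
Σℤ n f = foldr ℤ._+_ (+ 0) (map f (allFin n))

Σℕ : (n : ℕ) → (Fin n → ℕ) → ℕ
Σℕ n f = foldr ℕ._+_ 0 (map f (allFin n))

bias : (n : ℕ) .{{_ : NonZero n}} → 𝔽₂^ n → ℚ
bias n z = (+ ℤ.∣ Σℤ n (λ i → if z i then ℤ.-[1+ 0 ] else + 1) ∣) Q./ n

Δ : (n : ℕ) .{{_ : NonZero n}} → 𝔽₂^ n → 𝔽₂^ n → ℚ
Δ n x y = (+ Σℕ n (λ i → if x i xor y i then 1 else 0)) Q./ n

_⊕_ : {n : ℕ} → 𝔽₂^ n → 𝔽₂^ n → 𝔽₂^ n
(x ⊕ y) i = x i xor y i

zeroVec : (n : ℕ) → 𝔽₂^ n
zeroVec n i = false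

NonZeroVec : {n : ℕ} → 𝔽₂^ n → Set
NonZeroVec {n} x = ¬ (∀ i → x i ≡ false)

Code : ℕ → Set₁
Code n = 𝔽₂^ n → Set

record IsLinear {n : ℕ} (C : Code n) : Set where
  field
    has-zero : C (zeroVec n)
    closed-⊕ : ∀ x y → C x → C y → C (x ⊕ y)

-- a multiset W(k) ⊆ [n]^k of size m, given as an indexed family
Tuples : (m k n : ℕ) → Set
Tuples m k n = Fin m → Fin k → Fin n

dsum : {m k n : ℕ} → Tuples m k n → 𝔽₂^ n → 𝔽₂^ m
dsum {k = k} W z w = foldr _xor_ false (map (λ j → z (W w j)) (allFin k))

Balanced : (n : ℕ) .{{_ : NonZero n}} → Code n → ℚ → Set
Balanced n C ε = ∀ x → C x → NonZeroVec x → bias n x ≤ ε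

-- C' = dsum_W(C) is ε-balanced: every nonzero codeword dsum(z), z ∈ C, has bias ≤ ε
ImageBalanced : {m k n : ℕ} .{{_ : NonZero m}} → Tuples m k n → Code n → ℚ → Set
ImageBalanced {m} W C ε = ∀ z → C z → NonZeroVec (dsum W z) → bias m (dsum W z) ≤ ε

ParitySampler : {m k n : ℕ} .{{_ : NonZero n}} .{{_ : NonZero m}} →
                Tuples m k n → ℚ → ℚ → Set
ParitySampler {m} {k} {n} W ε₀ ε =
  ∀ z → bias n z ≤ ε₀ → bias m (dsum W z) ≤ ε

-- d ≤ 1/2 - √η   (for η ≥ 0), written without square roots:
-- 1/2 - d ≥ 0 and (1/2 - d)² ≥ η
≤½-√ : ℚ → ℚ → Set
≤½-√ d η = (0ℚ ≤ ½ - d) × (η ≤ (½ - d) * (½ - d))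

InL : {m k n : ℕ} .{{_ : NonZero m}} →
      Tuples m k n → Code n → ℚ → 𝔽₂^ m → 𝔽₂^ n → Set
InL {m} W C η ỹ z = C z × ≤½-√ (Δ m (dsum W z) ỹ) η

-- the sub-family of L' = {(z^(j), dsum z^(j))}_{j<M} indexed by S is a ζ-cover of L
IsCover : {m k n M : ℕ} .{{_ : NonZero n}} .{{_ : NonZero m}} →
          Tuples m k n → Code n → ℚ → 𝔽₂^ m →
          (Fin M → 𝔽₂^ n) → Subset M → ℚ → Set
IsCover {n = n} W C η ỹ L′ S ζ =
  ∀ z → InL W C η ỹ z →
  ∃ λ j → (j ∈ S) × ((1ℚ - (+ 2 Q./ 1) * ζ) < bias n (z ⊕ L′ j))

{-# OPTIONS --safe #-}

-- Prune L′ greedily, keeping an entry only if it is far from every kept entry, that is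
-- bias (z ⊕ z′) ≤ 1 − 2ζ. A discarded entry is close to a kept one, so the triangle
-- inequality bias (x ⊕ y) + bias (y ⊕ z) ≤ 1 + bias (x ⊕ z) makes the kept entries a
-- 2ζ-cover. By the parity sampler the lifts of the s kept entries are pairwise
-- η-uncorrelated, and each has correlation at least 2√η with ỹ. For the sum v of their
-- ±1 images, Cauchy–Schwarz gives 4η s² m² ≤ ⟨v, ỹ⟩² ≤ m ‖v‖² ≤ m² (s + s (s − 1) η),
-- hence s η ≤ 1.

module Submission where

open import Defs
open import Data.Nat using (ℕ; NonZero)
open import Data.Integer using (+_)
open import Data.Fin using (Fin)
open import Data.Fin.Subset using (Subset; ⊤; ∣_∣)
open import Data.Rational using (ℚ; _≤_; _<_; _-_; _*_; _/_; ½; 0ℚ; 1ℚ)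
open import Data.Product using (Σ; _×_; ∃)

open import Algebra.Bundles using (CommutativeRing)
open import Data.Bool using (Bool; true; false; _xor_; if_then_else_)
open import Data.Bool.Properties using (xor-comm; xor-assoc; xor-same; xor-∧-commutativeRing)
open import Algebra.Properties.CommutativeSemigroup
  (CommutativeRing.+-commutativeSemigroup xor-∧-commutativeRing) using (interchange)
open import Data.Fin.Subset using (_∪_; ⋃; ⁅_⁆) renaming (_∈_ to _∈ₛ_)
open import Data.Fin.Subset.Properties using (∣⊥∣≡0; ∣⁅x⁆∣≡1; p⊆p∪q; q⊆p∪q; x∈⁅x⁆)
open import Data.Integer as ℤ using (ℤ; 0ℤ; 1ℤ; -1ℤ)
import Data.Integer.Properties as ℤ
open import Data.Integer.Solver using (module +-*-Solver)
open import Data.List using (List; []; _∷_; map; foldr; length; allFin)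
open import Data.List.Membership.Propositional using (_∈_; find)
open import Data.List.Membership.Propositional.Properties using (∈-allFin)
open import Data.List.Properties using (length-tabulate; length-map)
open import Data.List.Relation.Unary.All as All using (All; []; _∷_)
import Data.List.Relation.Unary.All.Properties as All
open import Data.List.Relation.Unary.AllPairs as AllPairs using (AllPairs; []; _∷_)
import Data.List.Relation.Unary.AllPairs.Properties as AllPairs
open import Data.List.Relation.Unary.Any using (Any; here; there)
import Data.Nat as ℕ
open import Data.Nat using (suc)
open import Data.Nat.ListAction using (sum)
import Data.Nat.Properties as ℕ
open import Data.Product using (_,_; proj₁; proj₂)
open import Data.Rational using (↥_; ↧_; ↧ₙ_)
import Data.Rational as ℚ
import Data.Rational.Properties as ℚ
open import Algebra.Properties.AbelianGroup ℚ.+-0-abelianGroup using (xyx⁻¹≈y)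
open import Data.Rational.Solver using () renaming (module +-*-Solver to ℚ-Solver)
open import Data.Rational.Unnormalised as ℚᵘ using (mkℚᵘ; *≡*; *≤*)
import Data.Rational.Unnormalised.Properties as ℚᵘ
open import Data.Sum as Sum using (_⊎_; inj₁; inj₂)
open import Data.Vec using ([]; _∷_)
open import Function using (_∘_)
open import Relation.Binary using (Decidable)
open import Relation.Binary.PropositionalEquality
open import Relation.Nullary using (¬_; yes; no)

open +-*-Solver

private variable A B : Set

square-nonNeg : ∀ i → 0ℤ ℤ.≤ i ℤ.* i
square-nonNeg ℤ.+0       = ℤ.≤-refl
square-nonNeg ℤ.+[1+ n ] = ℤ.+≤+ ℕ.z≤n
square-nonNeg ℤ.-[1+ n ] = ℤ.+≤+ ℕ.z≤n

*-monoˡ-≤-of-0≤ : ∀ {c i j} → 0ℤ ℤ.≤ c → i ℤ.≤ j → c ℤ.* i ℤ.≤ c ℤ.* j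
*-monoˡ-≤-of-0≤ {c} 0≤c = ℤ.*-monoˡ-≤-nonNeg c {{ℤ.nonNegative 0≤c}}

*-pres-0≤ : ∀ {i j} → 0ℤ ℤ.≤ i → 0ℤ ℤ.≤ j → 0ℤ ℤ.≤ i ℤ.* j
*-pres-0≤ {i} {j} 0≤i 0≤j = subst (ℤ._≤ i ℤ.* j) (ℤ.*-zeroʳ i) (*-monoˡ-≤-of-0≤ 0≤i 0≤j)

i≤+∣i∣ : ∀ i → i ℤ.≤ + ℤ.∣ i ∣
i≤+∣i∣ (+ n)      = ℤ.≤-refl
i≤+∣i∣ ℤ.-[1+ n ] = ℤ.-≤+

-- Integer sums

∑ : List A → (A → ℤ) → ℤ
∑ xs f = foldr ℤ._+_ 0ℤ (map f xs)

∑-cong : {f g : A → ℤ} (xs : List A) → (∀ x → f x ≡ g x) → ∑ xs f ≡ ∑ xs g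
∑-cong []       f≗g = refl
∑-cong (x ∷ xs) f≗g = cong₂ ℤ._+_ (f≗g x) (∑-cong xs f≗g)

∑-+ : (xs : List A) (f g : A → ℤ) → ∑ xs (λ x → f x ℤ.+ g x) ≡ ∑ xs f ℤ.+ ∑ xs g
∑-+ []       f g = refl
∑-+ (x ∷ xs) f g rewrite ∑-+ xs f g =
  solve 4 (λ a b c d → (a :+ b) :+ (c :+ d) := (a :+ c) :+ (b :+ d)) refl (f x) (g x) (∑ xs f) (∑ xs g)

∑-*ˡ : (c : ℤ) (xs : List A) (f : A → ℤ) → ∑ xs (λ x → c ℤ.* f x) ≡ c ℤ.* ∑ xs f
∑-*ˡ c []       f = sym (ℤ.*-zeroʳ c)
∑-*ˡ c (x ∷ xs) f rewrite ∑-*ˡ c xs f = sym (ℤ.*-distribˡ-+ c (f x) (∑ xs f))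

∑-*ʳ : (c : ℤ) (xs : List A) (f : A → ℤ) → ∑ xs (λ x → f x ℤ.* c) ≡ ∑ xs f ℤ.* c
∑-*ʳ c []       f = sym (ℤ.*-zeroˡ c)
∑-*ʳ c (x ∷ xs) f rewrite ∑-*ʳ c xs f = sym (ℤ.*-distribʳ-+ c (f x) (∑ xs f))

∑-const : (c : ℤ) (xs : List A) → ∑ xs (λ _ → c) ≡ + length xs ℤ.* c
∑-const c []       = sym (ℤ.*-zeroˡ c)
∑-const c (x ∷ xs) rewrite ∑-const c xs =
  solve 2 (λ c s → c :+ s :* c := (con 1ℤ :+ s) :* c) refl c (+ length xs)

∑-mono-≤ : {f g : A → ℤ} {xs : List A} → All (λ x → f x ℤ.≤ g x) xs → ∑ xs f ℤ.≤ ∑ xs g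
∑-mono-≤ []            = ℤ.≤-refl
∑-mono-≤ (fx≤gx ∷ f≤g) = ℤ.+-mono-≤ fx≤gx (∑-mono-≤ f≤g)

∑-nonNeg : (xs : List A) {f : A → ℤ} → (∀ x → 0ℤ ℤ.≤ f x) → 0ℤ ℤ.≤ ∑ xs f
∑-nonNeg xs {f} 0≤f =
  subst (ℤ._≤ ∑ xs f) (trans (∑-const 0ℤ xs) (ℤ.*-zeroʳ (+ length xs))) (∑-mono-≤ (All.universal 0≤f xs))

∑-swap : (xs : List A) (ys : List B) (f : A → B → ℤ) →
         ∑ xs (λ x → ∑ ys (f x)) ≡ ∑ ys (λ y → ∑ xs (λ x → f x y))
∑-swap []       ys f = sym (trans (∑-const 0ℤ ys) (ℤ.*-zeroʳ (+ length ys)))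
∑-swap (x ∷ xs) ys f rewrite ∑-swap xs ys f = sym (∑-+ ys (f x) (λ y → ∑ xs (λ x → f x y)))

cauchy-schwarz : {I : Set} (xs : List I) (f g : I → ℤ) → 0ℤ ℤ.< ∑ xs (λ i → g i ℤ.* g i) →
  ∑ xs (λ i → f i ℤ.* g i) ℤ.* ∑ xs (λ i → f i ℤ.* g i) ℤ.≤
  ∑ xs (λ i → f i ℤ.* f i) ℤ.* ∑ xs (λ i → g i ℤ.* g i)
cauchy-schwarz {I} xs f g 0<gg = ℤ.0≤i-j⇒j≤i (ℤ.*-cancelˡ-≤-pos 0ℤ (ff ℤ.* gg ℤ.- fg ℤ.* fg) gg {{ℤ.positive 0<gg}}
  (subst₂ ℤ._≤_ (sym (ℤ.*-zeroʳ gg)) expand (∑-nonNeg xs (λ i → square-nonNeg (e i)))))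
  where
  open ≡-Reasoning
  ff = ∑ xs (λ i → f i ℤ.* f i)
  gg = ∑ xs (λ i → g i ℤ.* g i)
  fg = ∑ xs (λ i → f i ℤ.* g i)
  e : I → ℤ
  e i = gg ℤ.* f i ℤ.- fg ℤ.* g i
  a b c : ℤ
  a = gg ℤ.* gg
  b = ℤ.- (+ 2 ℤ.* gg ℤ.* fg)
  c = fg ℤ.* fg
  expand : ∑ xs (λ i → e i ℤ.* e i) ≡ gg ℤ.* (ff ℤ.* gg ℤ.- fg ℤ.* fg)
  expand = begin
    ∑ xs (λ i → e i ℤ.* e i)
      ≡⟨ ∑-cong xs (λ i → solve 4 (λ g s x y → (g :* x :- s :* y) :* (g :* x :- s :* y)
                                         := (g :* g) :* (x :* x) :+ (:- (con (+ 2) :* g :* s)) :* (x :* y) :+ (s :* s) :* (y :* y))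
                                  refl gg fg (f i) (g i)) ⟩
    ∑ xs (λ i → a ℤ.* (f i ℤ.* f i) ℤ.+ b ℤ.* (f i ℤ.* g i) ℤ.+ c ℤ.* (g i ℤ.* g i))
      ≡⟨ trans (∑-+ xs _ _) (cong (ℤ._+ ∑ xs (λ i → c ℤ.* (g i ℤ.* g i))) (∑-+ xs _ _)) ⟩
    ∑ xs (λ i → a ℤ.* (f i ℤ.* f i)) ℤ.+ ∑ xs (λ i → b ℤ.* (f i ℤ.* g i)) ℤ.+ ∑ xs (λ i → c ℤ.* (g i ℤ.* g i))
      ≡⟨ cong₂ ℤ._+_ (cong₂ ℤ._+_ (∑-*ˡ a xs _) (∑-*ˡ b xs _)) (∑-*ˡ c xs _) ⟩
    a ℤ.* ff ℤ.+ b ℤ.* fg ℤ.+ c ℤ.* gg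
      ≡⟨ solve 3 (λ x g s → (g :* g) :* x :+ (:- (con (+ 2) :* g :* s)) :* s :+ (s :* s) :* g := g :* (x :* g :- s :* s))
                 refl ff gg fg ⟩
    gg ℤ.* (ff ℤ.* gg ℤ.- fg ℤ.* fg) ∎

≤-*-if-≤-squares : ∀ {K q a b} → 0ℤ ℤ.≤ q → 0ℤ ℤ.≤ a → 0ℤ ℤ.≤ b →
  K ℤ.≤ q ℤ.* (a ℤ.* a) → K ℤ.≤ q ℤ.* (b ℤ.* b) → K ℤ.≤ q ℤ.* (a ℤ.* b)
≤-*-if-≤-squares {K} {q} {a} {b} 0≤q 0≤a 0≤b K≤qa² K≤qb² with ℤ.≤-total a b
... | inj₁ a≤b = ℤ.≤-trans K≤qa² (*-monoˡ-≤-of-0≤ 0≤q (*-monoˡ-≤-of-0≤ 0≤a a≤b))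
... | inj₂ b≤a = ℤ.≤-trans K≤qb² (subst (λ t → q ℤ.* (b ℤ.* b) ℤ.≤ q ℤ.* t) (ℤ.*-comm b a)
                                          (*-monoˡ-≤-of-0≤ 0≤q (*-monoˡ-≤-of-0≤ 0≤b b≤a)))

∑²-lower-bound : ∀ {K q} → 0ℤ ℤ.≤ q → (f : A → ℤ) {ys : List A} →
  All (λ y → 0ℤ ℤ.≤ f y × K ℤ.≤ q ℤ.* (f y ℤ.* f y)) ys →
  + length ys ℤ.* + length ys ℤ.* K ℤ.≤ q ℤ.* (∑ ys f ℤ.* ∑ ys f)
∑²-lower-bound {K = K} {q = q} 0≤q f [] = ℤ.≤-reflexive (trans (ℤ.*-zeroˡ K) (sym (ℤ.*-zeroʳ q)))
∑²-lower-bound {K = K} {q = q} 0≤q f {y ∷ ys} (fy-good ∷ good) = begin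
  (1ℤ ℤ.+ s) ℤ.* (1ℤ ℤ.+ s) ℤ.* K
    ≡⟨ solve 2 (λ s k → (con 1ℤ :+ s) :* (con 1ℤ :+ s) :* k := k :+ con (+ 2) :* (s :* k) :+ s :* s :* k) refl s K ⟩
  K ℤ.+ + 2 ℤ.* (s ℤ.* K) ℤ.+ s ℤ.* s ℤ.* K
    ≤⟨ ℤ.+-mono-≤ (ℤ.+-mono-≤ (proj₂ fy-good) (*-monoˡ-≤-of-0≤ {+ 2} (ℤ.+≤+ ℕ.z≤n) sK≤qcS))
                  (∑²-lower-bound 0≤q f good) ⟩
  q ℤ.* (c ℤ.* c) ℤ.+ + 2 ℤ.* (q ℤ.* (c ℤ.* S)) ℤ.+ q ℤ.* (S ℤ.* S)
    ≡⟨ solve 3 (λ q c s → q :* (c :* c) :+ con (+ 2) :* (q :* (c :* s)) :+ q :* (s :* s) := q :* ((c :+ s) :* (c :+ s)))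
               refl q c S ⟩
  q ℤ.* ((c ℤ.+ S) ℤ.* (c ℤ.+ S)) ∎
  where
  open ℤ.≤-Reasoning
  s = + length ys
  c = f y
  S = ∑ ys f
  sK≤qcS : s ℤ.* K ℤ.≤ q ℤ.* (c ℤ.* S)
  sK≤qcS = begin
    s ℤ.* K                           ≡⟨ ∑-const K ys ⟨
    ∑ ys (λ _ → K)                    ≤⟨ ∑-mono-≤ (All.map (λ fy′-good → ≤-*-if-≤-squares 0≤q
                                                      (proj₁ fy-good) (proj₁ fy′-good) (proj₂ fy-good) (proj₂ fy′-good)) good) ⟩
    ∑ ys (λ y′ → q ℤ.* (c ℤ.* f y′))  ≡⟨ ∑-*ˡ q ys (λ y′ → c ℤ.* f y′) ⟩
    q ℤ.* ∑ ys (λ y′ → c ℤ.* f y′)    ≡⟨ cong (q ℤ.*_) (∑-*ˡ c ys f) ⟩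
    q ℤ.* (c ℤ.* S)                   ∎

-- ±1 correlations

sgn : Bool → ℤ
sgn b = if b then -1ℤ else 1ℤ

sgn-xor : ∀ a b → sgn (a xor b) ≡ sgn a ℤ.* sgn b
sgn-xor true  true  = refl
sgn-xor true  false = refl
sgn-xor false true  = refl
sgn-xor false false = refl

sgn*sgn : ∀ a → sgn a ℤ.* sgn a ≡ 1ℤ
sgn*sgn true  = refl
sgn*sgn false = refl

sgn+sgn≤1+sgn-xor : ∀ a b → sgn a ℤ.+ sgn b ℤ.≤ 1ℤ ℤ.+ sgn (a xor b)
sgn+sgn≤1+sgn-xor true  true  = ℤ.-≤+
sgn+sgn≤1+sgn-xor true  false = ℤ.≤-refl
sgn+sgn≤1+sgn-xor false true  = ℤ.≤-refl
sgn+sgn≤1+sgn-xor false false = ℤ.≤-refl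

∣i∣≡sgn*i : ∀ i → ∃ λ σ → + ℤ.∣ i ∣ ≡ sgn σ ℤ.* i
∣i∣≡sgn*i (+ n)      = false , sym (ℤ.*-identityˡ (+ n))
∣i∣≡sgn*i ℤ.-[1+ n ] = true  , sym (ℤ.-1*i≡-i ℤ.-[1+ n ])

sgn*i≤∣i∣ : ∀ σ i → sgn σ ℤ.* i ℤ.≤ + ℤ.∣ i ∣
sgn*i≤∣i∣ false i = ℤ.≤-trans (ℤ.≤-reflexive (ℤ.*-identityˡ i)) (i≤+∣i∣ i)
sgn*i≤∣i∣ true  i = begin
  -1ℤ ℤ.* i       ≡⟨ ℤ.-1*i≡-i i ⟩
  ℤ.- i           ≤⟨ i≤+∣i∣ (ℤ.- i) ⟩
  + ℤ.∣ ℤ.- i ∣   ≡⟨ cong +_ (ℤ.∣-i∣≡∣i∣ i) ⟩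
  + ℤ.∣ i ∣       ∎
  where open ℤ.≤-Reasoning

xor-cancel-middle : ∀ a b c → (a xor b) xor (b xor c) ≡ a xor c
xor-cancel-middle a b c = begin
  (a xor b) xor (b xor c)   ≡⟨ xor-assoc a b (b xor c) ⟩
  a xor (b xor (b xor c))   ≡⟨ cong (a xor_) (xor-assoc b b c) ⟨
  a xor ((b xor b) xor c)   ≡⟨ cong (λ t → a xor (t xor c)) (xor-same b) ⟩
  a xor c                   ∎
  where open ≡-Reasoning

-- bias n w is definitionally + ∣ imbalance n w ∣ / n.
imbalance : (n : ℕ) → 𝔽₂^ n → ℤ
imbalance n w = ∑ (allFin n) (sgn ∘ w)

imbalance-cong : ∀ {n} {u v : 𝔽₂^ n} → (∀ i → u i ≡ v i) → imbalance n u ≡ imbalance n v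
imbalance-cong {n} u≗v = ∑-cong (allFin n) (cong sgn ∘ u≗v)

imbalance-comm : ∀ {n} (x y : 𝔽₂^ n) → imbalance n (x ⊕ y) ≡ imbalance n (y ⊕ x)
imbalance-comm x y = imbalance-cong (λ i → xor-comm (x i) (y i))

length-allFin : ∀ n → length (allFin n) ≡ n
length-allFin n = length-tabulate (λ i → i)

∑-allFin-1 : ∀ n → ∑ (allFin n) (λ _ → 1ℤ) ≡ + n
∑-allFin-1 n = trans (∑-const 1ℤ (allFin n)) (trans (ℤ.*-identityʳ _) (cong +_ (length-allFin n)))

sgn*imbalance : ∀ {n} σ (w : 𝔽₂^ n) → sgn σ ℤ.* imbalance n w ≡ imbalance n (λ i → σ xor w i)
sgn*imbalance {n} σ w =
  trans (sym (∑-*ˡ (sgn σ) (allFin n) (sgn ∘ w))) (∑-cong (allFin n) (λ i → sym (sgn-xor σ (w i))))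

∣imbalance∣≡imbalance-flip : ∀ {n} (w : 𝔽₂^ n) →
  ∃ λ σ → + ℤ.∣ imbalance n w ∣ ≡ imbalance n (λ i → σ xor w i)
∣imbalance∣≡imbalance-flip {n} w with ∣i∣≡sgn*i (imbalance n w)
... | σ , eq = σ , trans eq (sgn*imbalance σ w)

imbalance-flip≤∣imbalance∣ : ∀ {n} σ (w : 𝔽₂^ n) →
  imbalance n (λ i → σ xor w i) ℤ.≤ + ℤ.∣ imbalance n w ∣
imbalance-flip≤∣imbalance∣ σ w = subst (ℤ._≤ _) (sgn*imbalance σ w) (sgn*i≤∣i∣ σ _)

∣imbalance∣≤n : ∀ {n} (w : 𝔽₂^ n) → + ℤ.∣ imbalance n w ∣ ℤ.≤ + n
∣imbalance∣≤n {n} w with ∣imbalance∣≡imbalance-flip w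
... | σ , eq = begin
  + ℤ.∣ imbalance n w ∣                        ≡⟨ eq ⟩
  ∑ (allFin n) (λ i → sgn (σ xor w i))         ≤⟨ ∑-mono-≤ (All.universal (λ i → sgn≤1 (σ xor w i)) (allFin n)) ⟩
  ∑ (allFin n) (λ _ → 1ℤ)                      ≡⟨ ∑-allFin-1 n ⟩
  + n                                          ∎
  where
  open ℤ.≤-Reasoning
  sgn≤1 : ∀ b → sgn b ℤ.≤ 1ℤ
  sgn≤1 true  = ℤ.-≤+
  sgn≤1 false = ℤ.≤-refl

imbalance-triangle : ∀ {n} (u v : 𝔽₂^ n) →
  + ℤ.∣ imbalance n u ∣ ℤ.+ + ℤ.∣ imbalance n v ∣ ℤ.≤ + n ℤ.+ + ℤ.∣ imbalance n (u ⊕ v) ∣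
imbalance-triangle {n} u v with ∣imbalance∣≡imbalance-flip u | ∣imbalance∣≡imbalance-flip v
... | σ , eqᵤ | τ , eqᵥ = begin
  + ℤ.∣ imbalance n u ∣ ℤ.+ + ℤ.∣ imbalance n v ∣
    ≡⟨ cong₂ ℤ._+_ eqᵤ eqᵥ ⟩
  imbalance n u′ ℤ.+ imbalance n v′
    ≡⟨ ∑-+ (allFin n) (sgn ∘ u′) (sgn ∘ v′) ⟨
  ∑ (allFin n) (λ i → sgn (u′ i) ℤ.+ sgn (v′ i))
    ≤⟨ ∑-mono-≤ (All.universal (λ i → sgn+sgn≤1+sgn-xor (u′ i) (v′ i)) (allFin n)) ⟩
  ∑ (allFin n) (λ i → 1ℤ ℤ.+ sgn (u′ i xor v′ i))
    ≡⟨ ∑-+ (allFin n) (λ _ → 1ℤ) (λ i → sgn (u′ i xor v′ i)) ⟩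
  ∑ (allFin n) (λ _ → 1ℤ) ℤ.+ imbalance n (λ i → u′ i xor v′ i)
    ≡⟨ cong₂ ℤ._+_ (∑-allFin-1 n) (imbalance-cong (λ i → interchange σ (u i) τ (v i))) ⟩
  + n ℤ.+ imbalance n (λ i → (σ xor τ) xor (u ⊕ v) i)
    ≤⟨ ℤ.+-monoʳ-≤ (+ n) (imbalance-flip≤∣imbalance∣ (σ xor τ) (u ⊕ v)) ⟩
  + n ℤ.+ + ℤ.∣ imbalance n (u ⊕ v) ∣
    ∎
  where
  open ℤ.≤-Reasoning
  u′ v′ : 𝔽₂^ n
  u′ i = σ xor u i
  v′ i = τ xor v i

imbalance≡n-2weight : ∀ n (w : 𝔽₂^ n) → imbalance n w ≡ + n ℤ.- + 2 ℤ.* + Σℕ n (λ i → if w i then 1 else 0)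
imbalance≡n-2weight n w =
  trans (go (allFin n)) (cong (λ k → + k ℤ.- + 2 ℤ.* + weight (allFin n)) (length-allFin n))
  where
  weight : List (Fin n) → ℕ
  weight xs = sum (map (λ i → if w i then 1 else 0) xs)
  go : ∀ xs → ∑ xs (sgn ∘ w) ≡ + length xs ℤ.- + 2 ℤ.* + weight xs
  go [] = refl
  go (x ∷ xs) with w x
  ... | true  rewrite go xs | ℤ.pos-+ 1 (weight xs) =
    solve 2 (λ l d → con -1ℤ :+ (l :- con (+ 2) :* d) := (con 1ℤ :+ l) :- con (+ 2) :* (con 1ℤ :+ d))
            refl (+ length xs) (+ weight xs)
  ... | false rewrite go xs =
    solve 2 (λ l d → con 1ℤ :+ (l :- con (+ 2) :* d) := (con 1ℤ :+ l) :- con (+ 2) :* d)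
            refl (+ length xs) (+ weight xs)

-- A Johnson-type bound

Σχ : ∀ {n} → List (𝔽₂^ n) → Fin n → ℤ
Σχ ys i = ∑ ys (λ y → sgn (y i))

Σχ-inner : ∀ {n} (ys : List (𝔽₂^ n)) (x : 𝔽₂^ n) →
  ∑ (allFin n) (λ i → Σχ ys i ℤ.* sgn (x i)) ≡ ∑ ys (λ y → imbalance n (y ⊕ x))
Σχ-inner {n} ys x = begin
  ∑ (allFin n) (λ i → Σχ ys i ℤ.* sgn (x i))
    ≡⟨ ∑-cong (allFin n) (λ i → ∑-*ʳ (sgn (x i)) ys (λ y → sgn (y i))) ⟨
  ∑ (allFin n) (λ i → ∑ ys (λ y → sgn (y i) ℤ.* sgn (x i)))
    ≡⟨ ∑-swap (allFin n) ys (λ i y → sgn (y i) ℤ.* sgn (x i)) ⟩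
  ∑ ys (λ y → ∑ (allFin n) (λ i → sgn (y i) ℤ.* sgn (x i)))
    ≡⟨ ∑-cong ys (λ y → ∑-cong (allFin n) (λ i → sgn-xor (y i) (x i))) ⟨
  ∑ ys (λ y → imbalance n (y ⊕ x))                           ∎
  where open ≡-Reasoning

‖Σχ‖² : ∀ {n} → List (𝔽₂^ n) → ℤ
‖Σχ‖² {n} ys = ∑ (allFin n) (λ i → Σχ ys i ℤ.* Σχ ys i)

‖Σχ‖²-∷ : ∀ {n} (y : 𝔽₂^ n) (ys : List (𝔽₂^ n)) →
  ‖Σχ‖² (y ∷ ys) ≡ + n ℤ.+ + 2 ℤ.* ∑ ys (λ y′ → imbalance n (y′ ⊕ y)) ℤ.+ ‖Σχ‖² ys
‖Σχ‖²-∷ {n} y ys = begin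
  ∑ (allFin n) (λ i → (sgn (y i) ℤ.+ X i) ℤ.* (sgn (y i) ℤ.+ X i))
    ≡⟨ ∑-cong (allFin n) (λ i → square-expand (sgn (y i)) (X i)) ⟩
  ∑ (allFin n) (λ i → sgn (y i) ℤ.* sgn (y i) ℤ.+ + 2 ℤ.* (X i ℤ.* sgn (y i)) ℤ.+ X i ℤ.* X i)
    ≡⟨ trans (∑-+ (allFin n) _ _) (cong (ℤ._+ ‖Σχ‖² ys) (∑-+ (allFin n) _ _)) ⟩
  ∑ (allFin n) (λ i → sgn (y i) ℤ.* sgn (y i)) ℤ.+ ∑ (allFin n) (λ i → + 2 ℤ.* (X i ℤ.* sgn (y i))) ℤ.+
  ‖Σχ‖² ys
    ≡⟨ cong₂ (λ a b → a ℤ.+ b ℤ.+ ‖Σχ‖² ys)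
         (trans (∑-cong (allFin n) (sgn*sgn ∘ y)) (∑-allFin-1 n))
         (trans (∑-*ˡ (+ 2) (allFin n) _) (cong (+ 2 ℤ.*_) (Σχ-inner ys y))) ⟩
  + n ℤ.+ + 2 ℤ.* ∑ ys (λ y′ → imbalance n (y′ ⊕ y)) ℤ.+ ‖Σχ‖² ys ∎
  where
  open ≡-Reasoning
  X = Σχ ys
  square-expand : ∀ a x → (a ℤ.+ x) ℤ.* (a ℤ.+ x) ≡ a ℤ.* a ℤ.+ + 2 ℤ.* (x ℤ.* a) ℤ.+ x ℤ.* x
  square-expand = solve 2 (λ a x → (a :+ x) :* (a :+ x) := a :* a :+ con (+ 2) :* (x :* a) :+ x :* x) refl

‖Σχ‖²-upper-bound : ∀ {n} {p q} → 0ℤ ℤ.≤ q → (ys : List (𝔽₂^ n)) →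
  AllPairs (λ y y′ → q ℤ.* imbalance n (y ⊕ y′) ℤ.≤ p ℤ.* + n) ys →
  q ℤ.* ‖Σχ‖² ys ℤ.≤ + length ys ℤ.* (q ℤ.+ (+ length ys ℤ.- 1ℤ) ℤ.* p) ℤ.* + n
‖Σχ‖²-upper-bound {n} {p} {q} 0≤q [] [] = ℤ.≤-reflexive (begin
  q ℤ.* ∑ (allFin n) (λ _ → 0ℤ)   ≡⟨ cong (q ℤ.*_) (trans (∑-const 0ℤ (allFin n)) (ℤ.*-zeroʳ (+ length (allFin n)))) ⟩
  q ℤ.* 0ℤ                        ≡⟨ ℤ.*-zeroʳ q ⟩
  0ℤ                              ≡⟨ solve 3 (λ q p n → con 0ℤ := con 0ℤ :* (q :+ (con 0ℤ :- con 1ℤ) :* p) :* n)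
                                             refl q p (+ n) ⟩
  0ℤ ℤ.* (q ℤ.+ (0ℤ ℤ.- 1ℤ) ℤ.* p) ℤ.* + n ∎)
  where open ≡-Reasoning
‖Σχ‖²-upper-bound {n} {p} {q} 0≤q (y ∷ ys) (y-far ∷ far) = begin
  q ℤ.* ‖Σχ‖² (y ∷ ys)
    ≡⟨ cong (q ℤ.*_) (‖Σχ‖²-∷ y ys) ⟩
  q ℤ.* (+ n ℤ.+ + 2 ℤ.* R ℤ.+ ‖Σχ‖² ys)
    ≡⟨ solve 4 (λ q n r Q → q :* (n :+ con (+ 2) :* r :+ Q) := q :* n :+ con (+ 2) :* (q :* r) :+ q :* Q)
               refl q (+ n) R (‖Σχ‖² ys) ⟩
  q ℤ.* + n ℤ.+ + 2 ℤ.* (q ℤ.* R) ℤ.+ q ℤ.* ‖Σχ‖² ys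
    ≤⟨ ℤ.+-mono-≤ (ℤ.+-monoʳ-≤ (q ℤ.* + n) (*-monoˡ-≤-of-0≤ {+ 2} (ℤ.+≤+ ℕ.z≤n) qR≤spn))
                  (‖Σχ‖²-upper-bound 0≤q ys far) ⟩
  q ℤ.* + n ℤ.+ + 2 ℤ.* (s ℤ.* (p ℤ.* + n)) ℤ.+ s ℤ.* (q ℤ.+ (s ℤ.- 1ℤ) ℤ.* p) ℤ.* + n
    ≡⟨ solve 4 (λ q n s p → q :* n :+ con (+ 2) :* (s :* (p :* n)) :+ s :* (q :+ (s :- con 1ℤ) :* p) :* n
                         := (con 1ℤ :+ s) :* (q :+ ((con 1ℤ :+ s) :- con 1ℤ) :* p) :* n) refl q (+ n) s p ⟩
  (1ℤ ℤ.+ s) ℤ.* (q ℤ.+ ((1ℤ ℤ.+ s) ℤ.- 1ℤ) ℤ.* p) ℤ.* + n ∎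
  where
  open ℤ.≤-Reasoning
  s = + length ys
  R = ∑ ys (λ y′ → imbalance n (y′ ⊕ y))
  qR≤spn : q ℤ.* R ℤ.≤ s ℤ.* (p ℤ.* + n)
  qR≤spn = begin
    q ℤ.* R                                  ≡⟨ ∑-*ˡ q ys (λ y′ → imbalance n (y′ ⊕ y)) ⟨
    ∑ ys (λ y′ → q ℤ.* imbalance n (y′ ⊕ y)) ≤⟨ ∑-mono-≤ (All.map (λ {y′} → subst (λ t → q ℤ.* t ℤ.≤ p ℤ.* + n)
                                                                              (imbalance-comm y y′)) y-far) ⟩
    ∑ ys (λ _ → p ℤ.* + n)                   ≡⟨ ∑-const (p ℤ.* + n) ys ⟩
    s ℤ.* (p ℤ.* + n)                        ∎

johnson-arithmetic : ∀ s {p q} → 0ℤ ℤ.≤ p → 0ℤ ℤ.≤ q →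
  + s ℤ.* (+ 4 ℤ.* p ℤ.* + s) ℤ.≤ + s ℤ.* (q ℤ.+ (+ s ℤ.- 1ℤ) ℤ.* p) → + s ℤ.* p ℤ.≤ q
johnson-arithmetic ℕ.zero   {p} {q} 0≤p 0≤q _ = subst (ℤ._≤ q) (sym (ℤ.*-zeroˡ p)) 0≤q
johnson-arithmetic (suc s′) {p} {q} 0≤p 0≤q h = begin
  (1ℤ ℤ.+ s) ℤ.* p                          ≡⟨ solve 2 (λ s p → (con 1ℤ :+ s) :* p := p :+ s :* p) refl s p ⟩
  p ℤ.+ t                                   ≤⟨ ℤ.i≤i+j (p ℤ.+ t) (+ 3 ℤ.* p ℤ.+ + 2 ℤ.* t) {{ℤ.nonNegative 0≤3p+2t}} ⟩
  p ℤ.+ t ℤ.+ (+ 3 ℤ.* p ℤ.+ + 2 ℤ.* t)     ≡⟨ solve 2 (λ s p → p :+ s :* p :+ (con (+ 3) :* p :+ con (+ 2) :* (s :* p))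
                                                            := con (+ 4) :* p :* (con 1ℤ :+ s) :- s :* p) refl s p ⟩
  + 4 ℤ.* p ℤ.* (1ℤ ℤ.+ s) ℤ.- t            ≤⟨ ℤ.+-monoˡ-≤ (ℤ.- t) 4p[1+s]≤q+sp ⟩
  q ℤ.+ s ℤ.* p ℤ.- t                        ≡⟨ solve 2 (λ q t → q :+ t :- t := q) refl q t ⟩
  q                                         ∎
  where
  open ℤ.≤-Reasoning
  s = + s′
  t = s ℤ.* p
  0≤t : 0ℤ ℤ.≤ t
  0≤t = *-pres-0≤ {s} (ℤ.+≤+ ℕ.z≤n) 0≤p
  0≤3p+2t : 0ℤ ℤ.≤ + 3 ℤ.* p ℤ.+ + 2 ℤ.* t
  0≤3p+2t = ℤ.+-mono-≤ (*-pres-0≤ {+ 3} (ℤ.+≤+ ℕ.z≤n) 0≤p) (*-pres-0≤ {+ 2} (ℤ.+≤+ ℕ.z≤n) 0≤t)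
  4p[1+s]≤q+sp : + 4 ℤ.* p ℤ.* (1ℤ ℤ.+ s) ℤ.≤ q ℤ.+ s ℤ.* p
  4p[1+s]≤q+sp = ℤ.*-cancelˡ-≤-pos _ _ (1ℤ ℤ.+ s) (subst₂ ℤ._≤_ refl
    (cong ((1ℤ ℤ.+ s) ℤ.*_) (solve 3 (λ q s p → q :+ ((con 1ℤ :+ s) :- con 1ℤ) :* p := q :+ s :* p) refl q s p)) h)

-- With η = p / q: the ys are pairwise η-uncorrelated and 2√η-correlated with x.
johnson-bound : ∀ {n} .{{_ : NonZero n}} {p q} → 0ℤ ℤ.≤ p → 0ℤ ℤ.≤ q →
  (x : 𝔽₂^ n) (ys : List (𝔽₂^ n)) →
  AllPairs (λ y y′ → q ℤ.* imbalance n (y ⊕ y′) ℤ.≤ p ℤ.* + n) ys →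
  All (λ y → 0ℤ ℤ.≤ imbalance n (y ⊕ x) ×
             + 4 ℤ.* p ℤ.* (+ n ℤ.* + n) ℤ.≤ q ℤ.* (imbalance n (y ⊕ x) ℤ.* imbalance n (y ⊕ x))) ys →
  + length ys ℤ.* p ℤ.≤ q
johnson-bound {n@(suc _)} {p} {q} 0≤p 0≤q x ys far correlated =
  johnson-arithmetic (length ys) 0≤p 0≤q (ℤ.*-cancelˡ-≤-pos _ _ (N ℤ.* N) (subst₂ ℤ._≤_ lhs≡ rhs≡ chain))
  where
  open ℤ.≤-Reasoning
  N = + n
  s = + length ys
  P = ∑ ys (λ y → imbalance n (y ⊕ x))
  ∑χ²≡n : ∑ (allFin n) (λ i → sgn (x i) ℤ.* sgn (x i)) ≡ N
  ∑χ²≡n = trans (∑-cong (allFin n) (sgn*sgn ∘ x)) (∑-allFin-1 n)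
  chain : s ℤ.* s ℤ.* (+ 4 ℤ.* p ℤ.* (N ℤ.* N)) ℤ.≤ s ℤ.* (q ℤ.+ (s ℤ.- 1ℤ) ℤ.* p) ℤ.* N ℤ.* N
  chain = begin
    s ℤ.* s ℤ.* (+ 4 ℤ.* p ℤ.* (N ℤ.* N))
      ≤⟨ ∑²-lower-bound 0≤q (λ y → imbalance n (y ⊕ x)) correlated ⟩
    q ℤ.* (P ℤ.* P)
      ≡⟨ cong (λ t → q ℤ.* (t ℤ.* t)) (Σχ-inner ys x) ⟨
    q ℤ.* (∑ (allFin n) (λ i → Σχ ys i ℤ.* sgn (x i)) ℤ.* ∑ (allFin n) (λ i → Σχ ys i ℤ.* sgn (x i)))
      ≤⟨ *-monoˡ-≤-of-0≤ 0≤q (cauchy-schwarz (allFin n) (Σχ ys) (sgn ∘ x)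
                                 (subst (0ℤ ℤ.<_) (sym ∑χ²≡n) (ℤ.+<+ (ℕ.s≤s ℕ.z≤n)))) ⟩
    q ℤ.* (‖Σχ‖² ys ℤ.* ∑ (allFin n) (λ i → sgn (x i) ℤ.* sgn (x i)))
      ≡⟨ cong (λ t → q ℤ.* (‖Σχ‖² ys ℤ.* t)) ∑χ²≡n ⟩
    q ℤ.* (‖Σχ‖² ys ℤ.* N)
      ≡⟨ ℤ.*-assoc q (‖Σχ‖² ys) N ⟨
    q ℤ.* ‖Σχ‖² ys ℤ.* N
      ≤⟨ ℤ.*-monoʳ-≤-nonNeg N (‖Σχ‖²-upper-bound 0≤q ys far) ⟩
    s ℤ.* (q ℤ.+ (s ℤ.- 1ℤ) ℤ.* p) ℤ.* N ℤ.* N ∎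
  lhs≡ : s ℤ.* s ℤ.* (+ 4 ℤ.* p ℤ.* (N ℤ.* N)) ≡ N ℤ.* N ℤ.* (s ℤ.* (+ 4 ℤ.* p ℤ.* s))
  lhs≡ = solve 3 (λ s p n → s :* s :* (con (+ 4) :* p :* (n :* n)) := n :* n :* (s :* (con (+ 4) :* p :* s)))
                 refl s p N
  rhs≡ : s ℤ.* (q ℤ.+ (s ℤ.- 1ℤ) ℤ.* p) ℤ.* N ℤ.* N ≡ N ℤ.* N ℤ.* (s ℤ.* (q ℤ.+ (s ℤ.- 1ℤ) ℤ.* p))
  rhs≡ = solve 4 (λ s q p n → s :* (q :+ (s :- con 1ℤ) :* p) :* n :* n := n :* n :* (s :* (q :+ (s :- con 1ℤ) :* p)))
                 refl s q p N

toℚᵘ-/ : ∀ i d → ℚ.toℚᵘ (i / suc d) ℚᵘ.≃ mkℚᵘ i d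
toℚᵘ-/ i d = ℚ.toℚᵘ-fromℚᵘ (mkℚᵘ i d)

/-≤-/⁺ : ∀ i j a b → i ℤ.* + suc b ℤ.≤ j ℤ.* + suc a → i / suc a ≤ j / suc b
/-≤-/⁺ i j a b k = ℚ.toℚᵘ-cancel-≤
  (ℚᵘ.≤-respʳ-≃ (ℚᵘ.≃-sym (toℚᵘ-/ j b)) (ℚᵘ.≤-respˡ-≃ (ℚᵘ.≃-sym (toℚᵘ-/ i a)) (*≤* k)))

/-≤-/⁻ : ∀ i j a b → i / suc a ≤ j / suc b → i ℤ.* + suc b ℤ.≤ j ℤ.* + suc a
/-≤-/⁻ i j a b h =
  ℚᵘ.drop-*≤* (ℚᵘ.≤-respʳ-≃ (toℚᵘ-/ j b) (ℚᵘ.≤-respˡ-≃ (toℚᵘ-/ i a) (ℚ.toℚᵘ-mono-≤ h)))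

/-mono-≤ : ∀ {i j} d → i ℤ.≤ j → i / suc d ≤ j / suc d
/-mono-≤ {i} {j} d i≤j = /-≤-/⁺ i j d d (ℤ.*-monoʳ-≤-nonNeg (+ suc d) i≤j)

toℚᵘ≃⇒≡/ : ∀ {p i d} → ℚ.toℚᵘ p ℚᵘ.≃ mkℚᵘ i d → p ≡ i / suc d
toℚᵘ≃⇒≡/ {i = i} {d} h = ℚ.toℚᵘ-injective (ℚᵘ.≃-trans h (ℚᵘ.≃-sym (toℚᵘ-/ i d)))

/-+-/ : ∀ i j d → i / suc d ℚ.+ j / suc d ≡ (i ℤ.+ j) / suc d
/-+-/ i j d = toℚᵘ≃⇒≡/ (begin
  ℚ.toℚᵘ (i / suc d ℚ.+ j / suc d)               ≈⟨ ℚ.toℚᵘ-homo-+ (i / suc d) (j / suc d) ⟩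
  ℚ.toℚᵘ (i / suc d) ℚᵘ.+ ℚ.toℚᵘ (j / suc d)     ≈⟨ ℚᵘ.+-cong (toℚᵘ-/ i d) (toℚᵘ-/ j d) ⟩
  mkℚᵘ i d ℚᵘ.+ mkℚᵘ j d                         ≈⟨ *≡* (trans eq (cong ((i ℤ.+ j) ℤ.*_) (sym (ℤ.pos-* (suc d) (suc d))))) ⟩
  mkℚᵘ (i ℤ.+ j) d                               ∎)
  where
  open ℚᵘ.≃-Reasoning
  eq : (i ℤ.* + suc d ℤ.+ j ℤ.* + suc d) ℤ.* + suc d ≡ (i ℤ.+ j) ℤ.* (+ suc d ℤ.* + suc d)
  eq = solve 3 (λ i j n → (i :* n :+ j :* n) :* n := (i :+ j) :* (n :* n)) refl i j (+ suc d)

n/n≡1 : ∀ d → + suc d / suc d ≡ 1ℚ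
n/n≡1 d = sym (toℚᵘ≃⇒≡/ {1ℚ} {+ suc d} {d} (*≡* (ℤ.*-comm 1ℤ (+ suc d))))

/-*-/ : ∀ i j a b → (i / suc a) ℚ.* (j / suc b) ≡ (i ℤ.* j) / (suc a ℕ.* suc b)
/-*-/ i j a b =
  toℚᵘ≃⇒≡/ (ℚᵘ.≃-trans (ℚ.toℚᵘ-homo-* (i / suc a) (j / suc b)) (ℚᵘ.*-cong (toℚᵘ-/ i a) (toℚᵘ-/ j b)))

½-/ : ∀ i d → ½ - i / suc d ≡ (+ suc d ℤ.- + 2 ℤ.* i) / (2 ℕ.* suc d)
½-/ i d = toℚᵘ≃⇒≡/ (begin
  ℚ.toℚᵘ (½ - i / suc d)
    ≈⟨ ℚ.toℚᵘ-homo-+ ½ (ℚ.- (i / suc d)) ⟩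
  ℚ.toℚᵘ ½ ℚᵘ.+ ℚ.toℚᵘ (ℚ.- (i / suc d))
    ≈⟨ ℚᵘ.+-congʳ (ℚ.toℚᵘ ½) (ℚᵘ.≃-trans (ℚ.toℚᵘ-homo‿- (i / suc d)) (ℚᵘ.-‿cong (toℚᵘ-/ i d))) ⟩
  mkℚᵘ 1ℤ 1 ℚᵘ.+ mkℚᵘ (ℤ.- i) d
    ≈⟨ *≡* (cong (ℤ._* + (2 ℕ.* suc d)) numerator≡) ⟩
  mkℚᵘ (+ suc d ℤ.- + 2 ℤ.* i) (ℕ.pred (2 ℕ.* suc d)) ∎)
  where
  open ℚᵘ.≃-Reasoning
  numerator≡ : 1ℤ ℤ.* + suc d ℤ.+ ℤ.- i ℤ.* + 2 ≡ + suc d ℤ.- + 2 ℤ.* i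
  numerator≡ = solve 2 (λ i n → con 1ℤ :* n :+ (:- i) :* con (+ 2) := n :- con (+ 2) :* i) refl i (+ suc d)

bias≤1 : ∀ {n} .{{_ : NonZero n}} (w : 𝔽₂^ n) → bias n w ≤ 1ℚ
bias≤1 {suc d} w = subst (bias (suc d) w ≤_) (n/n≡1 d) (/-mono-≤ d (∣imbalance∣≤n w))

bias-⊕-self : ∀ {n} .{{_ : NonZero n}} (x : 𝔽₂^ n) → bias n (x ⊕ x) ≡ 1ℚ
bias-⊕-self {suc d} x = begin
  + ℤ.∣ imbalance (suc d) (x ⊕ x) ∣ / suc d      ≡⟨ cong (λ t → + ℤ.∣ t ∣ / suc d) (imbalance-cong (xor-same ∘ x)) ⟩
  + ℤ.∣ ∑ (allFin (suc d)) (λ _ → 1ℤ) ∣ / suc d  ≡⟨ cong (λ t → + ℤ.∣ t ∣ / suc d) (∑-allFin-1 (suc d)) ⟩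
  + suc d / suc d                               ≡⟨ n/n≡1 d ⟩
  1ℚ                                            ∎
  where open ≡-Reasoning

bias-triangle : ∀ {n} .{{_ : NonZero n}} (u v : 𝔽₂^ n) → bias n u ℚ.+ bias n v ≤ 1ℚ ℚ.+ bias n (u ⊕ v)
bias-triangle {suc d} u v = begin
  a / suc d ℚ.+ b / suc d               ≡⟨ /-+-/ a b d ⟩
  (a ℤ.+ b) / suc d                     ≤⟨ /-mono-≤ d (imbalance-triangle u v) ⟩
  (+ suc d ℤ.+ c) / suc d               ≡⟨ /-+-/ (+ suc d) c d ⟨
  + suc d / suc d ℚ.+ c / suc d         ≡⟨ cong (ℚ._+ c / suc d) (n/n≡1 d) ⟩
  1ℚ ℚ.+ c / suc d                      ∎
  where
  open ℚ.≤-Reasoning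
  a = + ℤ.∣ imbalance (suc d) u ∣
  b = + ℤ.∣ imbalance (suc d) v ∣
  c = + ℤ.∣ imbalance (suc d) (u ⊕ v) ∣

bias-⊕-transitive : ∀ {n} .{{_ : NonZero n}} {ε} (x y z : 𝔽₂^ n) →
  ε < bias n (x ⊕ y) → ε < bias n (y ⊕ z) → ε ℚ.+ ε - 1ℚ < bias n (x ⊕ z)
bias-⊕-transitive {n} {ε} x y z ε<xy ε<yz = begin-strict
  ε ℚ.+ ε - 1ℚ                                          <⟨ ℚ.+-monoˡ-< (ℚ.- 1ℚ) (ℚ.+-mono-< ε<xy ε<yz) ⟩
  bias n (x ⊕ y) ℚ.+ bias n (y ⊕ z) - 1ℚ                ≤⟨ ℚ.+-monoˡ-≤ (ℚ.- 1ℚ) (bias-triangle (x ⊕ y) (y ⊕ z)) ⟩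
  1ℚ ℚ.+ bias n ((x ⊕ y) ⊕ (y ⊕ z)) - 1ℚ                ≡⟨ xyx⁻¹≈y 1ℚ (bias n ((x ⊕ y) ⊕ (y ⊕ z))) ⟩
  bias n ((x ⊕ y) ⊕ (y ⊕ z))                            ≡⟨ cong (λ t → + ℤ.∣ t ∣ / n)
                                                             (imbalance-cong (λ i → xor-cancel-middle (x i) (y i) (z i))) ⟩
  bias n (x ⊕ z)                                        ∎
  where open ℚ.≤-Reasoning

bias≤⇒imbalance≤ : ∀ {n} .{{_ : NonZero n}} (w : 𝔽₂^ n) {η} → bias n w ≤ η →
  ↧ η ℤ.* imbalance n w ℤ.≤ ↥ η ℤ.* + n
bias≤⇒imbalance≤ {suc d} w {η} h = begin
  ↧ η ℤ.* imbalance (suc d) w  ≤⟨ ℤ.*-monoˡ-≤-nonNeg (↧ η) (i≤+∣i∣ (imbalance (suc d) w)) ⟩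
  ↧ η ℤ.* a                    ≡⟨ ℤ.*-comm (↧ η) a ⟩
  a ℤ.* ↧ η                    ≤⟨ /-≤-/⁻ a (↥ η) d (ℚ.denominator-1 η)
                                          (subst (bias (suc d) w ≤_) (sym (ℚ.↥p/↧p≡p η)) h) ⟩
  ↥ η ℤ.* + suc d              ∎
  where
  open ℤ.≤-Reasoning
  a = + ℤ.∣ imbalance (suc d) w ∣

½-Δ≡imbalance/2n : ∀ d (x y : 𝔽₂^ (suc d)) →
  ½ - Δ (suc d) x y ≡ imbalance (suc d) (x ⊕ y) / (2 ℕ.* suc d)
½-Δ≡imbalance/2n d x y = trans (½-/ (+ Σℕ (suc d) (λ i → if (x ⊕ y) i then 1 else 0)) d)
  (cong (λ i → i / (2 ℕ.* suc d)) (sym (imbalance≡n-2weight (suc d) (x ⊕ y))))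

≤½-√⇒correlated : ∀ {n} .{{_ : NonZero n}} (x y : 𝔽₂^ n) {η} → ≤½-√ (Δ n x y) η →
  0ℤ ℤ.≤ imbalance n (x ⊕ y) ×
  + 4 ℤ.* ↥ η ℤ.* (+ n ℤ.* + n) ℤ.≤ ↧ η ℤ.* (imbalance n (x ⊕ y) ℤ.* imbalance n (x ⊕ y))
≤½-√⇒correlated {suc d} x y {η} (0≤t , η≤t²) = 0≤c , 4ηn²≤c²
  where
  c = imbalance (suc d) (x ⊕ y)
  2n = 2 ℕ.* suc d
  t≡ = ½-Δ≡imbalance/2n d x y
  0≤c : 0ℤ ℤ.≤ c
  0≤c = subst₂ ℤ._≤_ (ℤ.*-zeroˡ (+ 2n)) (ℤ.*-identityʳ c) (/-≤-/⁻ 0ℤ c 0 (ℕ.pred 2n) (subst (0ℚ ≤_) t≡ 0≤t))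
  t²≡ : (½ - Δ (suc d) x y) ℚ.* (½ - Δ (suc d) x y) ≡ (c ℤ.* c) / (2n ℕ.* 2n)
  t²≡ = trans (cong₂ ℚ._*_ t≡ t≡) (/-*-/ c c _ _)
  4ηn²≤c² : + 4 ℤ.* ↥ η ℤ.* (+ suc d ℤ.* + suc d) ℤ.≤ ↧ η ℤ.* (c ℤ.* c)
  4ηn²≤c² = subst₂ ℤ._≤_ 4ηn²≡ (ℤ.*-comm (c ℤ.* c) (↧ η))
    (/-≤-/⁻ (↥ η) (c ℤ.* c) (ℚ.denominator-1 η) (ℕ.pred (2n ℕ.* 2n))
            (subst₂ _≤_ (sym (ℚ.↥p/↧p≡p η)) t²≡ η≤t²))
    where
    4ηn²≡ : ↥ η ℤ.* + (2n ℕ.* 2n) ≡ + 4 ℤ.* ↥ η ℤ.* (+ suc d ℤ.* + suc d)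
    4ηn²≡ = begin
      ↥ η ℤ.* + (2n ℕ.* 2n)                           ≡⟨ cong (↥ η ℤ.*_) (ℤ.pos-* 2n 2n) ⟩
      ↥ η ℤ.* (+ 2n ℤ.* + 2n)                         ≡⟨ cong (λ k → ↥ η ℤ.* (k ℤ.* k)) (ℤ.pos-* 2 (suc d)) ⟩
      ↥ η ℤ.* ((+ 2 ℤ.* + suc d) ℤ.* (+ 2 ℤ.* + suc d))
        ≡⟨ solve 2 (λ p n → p :* ((con (+ 2) :* n) :* (con (+ 2) :* n)) := con (+ 4) :* p :* (n :* n))
                   refl (↥ η) (+ suc d) ⟩
      + 4 ℤ.* ↥ η ℤ.* (+ suc d ℤ.* + suc d)           ∎
      where open ≡-Reasoning

0<⇒0≤↥ : ∀ {η} → 0ℚ < η → 0ℤ ℤ.≤ ↥ η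
0<⇒0≤↥ {η} 0<η = ℤ.<⇒≤ (subst₂ ℤ._<_ (ℤ.*-zeroˡ (↧ η)) (ℤ.*-identityʳ (↥ η)) (ℚ.drop-*<* 0<η))

size*η≤1 : ∀ s η → + s ℤ.* ↥ η ℤ.≤ ↧ η → (+ s / 1) ℚ.* η ≤ 1ℚ
size*η≤1 s η sp≤q = subst (_≤ 1ℚ) (sym s*η≡)
  (/-≤-/⁺ (+ s ℤ.* ↥ η) 1ℤ (ℕ.pred (1 ℕ.* ↧ₙ η)) 0 (subst₂ ℤ._≤_ (sym (ℤ.*-identityʳ _)) q≡ sp≤q))
  where
  s*η≡ : (+ s / 1) ℚ.* η ≡ (+ s ℤ.* ↥ η) / (1 ℕ.* ↧ₙ η)
  s*η≡ = trans (cong ((+ s / 1) ℚ.*_) (sym (ℚ.↥p/↧p≡p η))) (/-*-/ (+ s) (↥ η) 0 (ℚ.denominator-1 η))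
  q≡ : ↧ η ≡ 1ℤ ℤ.* + (1 ℕ.* ↧ₙ η)
  q≡ = sym (trans (ℤ.*-identityˡ _) (cong +_ (ℕ.*-identityˡ (↧ₙ η))))

-- Greedy pruning

module Greedy {R : A → A → Set} (R? : Decidable R) where

  greedy : List A → List A
  greedy []       = []
  greedy (x ∷ xs) with All.all? (R? x) (greedy xs)
  ... | yes _ = x ∷ greedy xs
  ... | no  _ = greedy xs

  greedy-pairwise : ∀ xs → AllPairs R (greedy xs)
  greedy-pairwise []       = []
  greedy-pairwise (x ∷ xs) with All.all? (R? x) (greedy xs)
  ... | yes x-R = x-R ∷ greedy-pairwise xs
  ... | no  _   = greedy-pairwise xs

  greedy-maximal : ∀ {x xs} → x ∈ xs → x ∈ greedy xs ⊎ Any (¬_ ∘ R x) (greedy xs)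
  greedy-maximal {x} {_ ∷ xs} (here refl) with All.all? (R? x) (greedy xs)
  ... | yes _     = inj₁ (here refl)
  ... | no  ¬x-R  = inj₂ (All.¬All⇒Any¬ (R? x) (greedy xs) ¬x-R)
  greedy-maximal {x} {y ∷ xs} (there x∈xs) with All.all? (R? y) (greedy xs)
  ... | yes _ = Sum.map there there (greedy-maximal x∈xs)
  ... | no  _ = greedy-maximal x∈xs

∣p∪q∣≤∣p∣+∣q∣ : ∀ {n} (p q : Subset n) → ∣ p ∪ q ∣ ℕ.≤ ∣ p ∣ ℕ.+ ∣ q ∣
∣p∪q∣≤∣p∣+∣q∣ []          []          = ℕ.z≤n
∣p∪q∣≤∣p∣+∣q∣ (true ∷ p)  (true ∷ q)  =
  ℕ.s≤s (ℕ.≤-trans (∣p∪q∣≤∣p∣+∣q∣ p q) (ℕ.+-monoʳ-≤ ∣ p ∣ (ℕ.n≤1+n ∣ q ∣)))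
∣p∪q∣≤∣p∣+∣q∣ (true ∷ p)  (false ∷ q) = ℕ.s≤s (∣p∪q∣≤∣p∣+∣q∣ p q)
∣p∪q∣≤∣p∣+∣q∣ (false ∷ p) (true ∷ q)  =
  ℕ.≤-trans (ℕ.s≤s (∣p∪q∣≤∣p∣+∣q∣ p q)) (ℕ.≤-reflexive (sym (ℕ.+-suc ∣ p ∣ ∣ q ∣)))
∣p∪q∣≤∣p∣+∣q∣ (false ∷ p) (false ∷ q) = ∣p∪q∣≤∣p∣+∣q∣ p q

fromList : ∀ {n} → List (Fin n) → Subset n
fromList = ⋃ ∘ map ⁅_⁆

∣fromList∣≤length : ∀ {n} (xs : List (Fin n)) → ∣ fromList xs ∣ ℕ.≤ length xs
∣fromList∣≤length {n} []       = ℕ.≤-reflexive (∣⊥∣≡0 n)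
∣fromList∣≤length     (x ∷ xs) = ℕ.≤-trans (∣p∪q∣≤∣p∣+∣q∣ ⁅ x ⁆ (fromList xs))
  (subst (λ k → k ℕ.+ ∣ fromList xs ∣ ℕ.≤ suc (length xs)) (sym (∣⁅x⁆∣≡1 x)) (ℕ.s≤s (∣fromList∣≤length xs)))

∈fromList : ∀ {n} {x : Fin n} {xs} → x ∈ xs → x ∈ₛ fromList xs
∈fromList {xs = y ∷ xs} (here refl) = p⊆p∪q (fromList xs) (x∈⁅x⁆ y)
∈fromList {xs = y ∷ xs} (there x∈xs) = q⊆p∪q ⁅ y ⁆ (fromList xs) (∈fromList x∈xs)

module Pruning {n M} .{{_ : NonZero n}} (L′ : Fin M → 𝔽₂^ n) (ε : ℚ) where

  Far : Fin M → Fin M → Set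
  Far j l = bias n (L′ j ⊕ L′ l) ≤ ε

  open Greedy {R = Far} (λ j l → bias n (L′ j ⊕ L′ l) ℚ.≤? ε)

  chosen : List (Fin M)
  chosen = greedy (allFin M)

  chosen-far : AllPairs Far chosen
  chosen-far = greedy-pairwise (allFin M)

  chosen-covers : ∀ z j → ε < bias n (z ⊕ L′ j) →
    ∃ λ l → l ∈ chosen × ε ℚ.+ ε - 1ℚ < bias n (z ⊕ L′ l)
  chosen-covers z j ε<zj = Sum.[ kept , pruned ]′ (greedy-maximal (∈-allFin j))
    where
    kept : j ∈ chosen → ∃ λ l → l ∈ chosen × ε ℚ.+ ε - 1ℚ < bias n (z ⊕ L′ l)
    kept j∈chosen = j , j∈chosen , bias-⊕-transitive z (L′ j) (L′ j) ε<zj ε<jj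
      where
      ε<jj : ε < bias n (L′ j ⊕ L′ j)
      ε<jj = subst (ε <_) (sym (bias-⊕-self (L′ j))) (ℚ.<-≤-trans ε<zj (bias≤1 (z ⊕ L′ j)))
    pruned : Any (¬_ ∘ Far j) chosen → ∃ λ l → l ∈ chosen × ε ℚ.+ ε - 1ℚ < bias n (z ⊕ L′ l)
    pruned near = let l , l∈chosen , ¬far = find near in
      l , l∈chosen , bias-⊕-transitive z (L′ j) (L′ l) ε<zj (ℚ.≰⇒> ¬far)

xor-parity : (f g : A → Bool) (xs : List A) →
  foldr _xor_ false (map (λ x → f x xor g x) xs) ≡
  foldr _xor_ false (map f xs) xor foldr _xor_ false (map g xs)
xor-parity f g []       = refl
xor-parity f g (x ∷ xs) rewrite xor-parity f g xs = interchange (f x) (g x) _ _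

dsum-⊕ : ∀ {m k n} (W : Tuples m k n) (a b : 𝔽₂^ n) w → dsum W (a ⊕ b) w ≡ (dsum W a ⊕ dsum W b) w
dsum-⊕ {k = k} W a b w = xor-parity (λ j → a (W w j)) (λ j → b (W w j)) (allFin k)

parity-sampler-far : ∀ {m k n} .{{_ : NonZero n}} .{{_ : NonZero m}} {W : Tuples m k n} {ε η} →
  ParitySampler W ε η → ∀ a b → bias n (a ⊕ b) ≤ ε →
  ↧ η ℤ.* imbalance m (dsum W a ⊕ dsum W b) ℤ.≤ ↥ η ℤ.* + m
parity-sampler-far {m} {W = W} {η = η} sampler a b far =
  subst (λ t → ↧ η ℤ.* t ℤ.≤ ↥ η ℤ.* + m) (imbalance-cong (dsum-⊕ W a b))
        (bias≤⇒imbalance≤ (dsum W (a ⊕ b)) (sampler (a ⊕ b) far))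

1-2[2ζ]≡ε+ε-1 : ∀ ζ → 1ℚ - (+ 2 / 1) * ((+ 2 / 1) * ζ) ≡ (1ℚ - (+ 2 / 1) * ζ) ℚ.+ (1ℚ - (+ 2 / 1) * ζ) - 1ℚ
1-2[2ζ]≡ε+ε-1 =
  Q.solve 1 (λ ζ → one Q.:- two Q.:* (two Q.:* ζ) Q.:= (one Q.:- two Q.:* ζ) Q.:+ (one Q.:- two Q.:* ζ) Q.:- one) refl
  where
  module Q = ℚ-Solver
  one = Q.con 1ℚ
  two = Q.con (+ 2 / 1)

mainTheorem10 : (m k n M : ℕ) .{{_ : NonZero n}} .{{_ : NonZero m}} →
    (W : Tuples m k n) (C : Code n) (η₀ η ζ : ℚ) →
    IsLinear C → Balanced n C η₀ →
    0ℚ < η → ImageBalanced W C η →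
    (ỹ : 𝔽₂^ m) (L′ : Fin M → 𝔽₂^ n) →
    ζ < ½ →
    IsCover W C η ỹ L′ ⊤ ζ →
    (∀ j → ≤½-√ (Δ m (dsum W (L′ j)) ỹ) η) →
    ParitySampler W (1ℚ - (+ 2 / 1) * ζ) η →
    ∃ λ (S : Subset M) →
      ((+ ∣ S ∣ / 1) * η ≤ 1ℚ) × IsCover W C η ỹ L′ S ((+ 2 / 1) * ζ)
mainTheorem10 m k n M W C η₀ η ζ _ _ 0<η _ ỹ L′ _ cover close-to-ỹ sampler = fromList chosen , size , cover′
  where
  open Pruning L′ (1ℚ - (+ 2 / 1) * ζ)
  ys = map (dsum W ∘ L′) chosen
  0≤↥η = 0<⇒0≤↥ 0<η
  length-bound : + length ys ℤ.* ↥ η ℤ.≤ ↧ η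
  length-bound = johnson-bound 0≤↥η (ℤ.+≤+ ℕ.z≤n) ỹ ys
    (AllPairs.map⁺ (AllPairs.map (λ {j} {l} → parity-sampler-far {W = W} sampler (L′ j) (L′ l)) chosen-far))
    (All.map⁺ (All.universal (λ j → ≤½-√⇒correlated (dsum W (L′ j)) ỹ (close-to-ỹ j)) chosen))
  ∣S∣≤length-ys : ∣ fromList chosen ∣ ℕ.≤ length ys
  ∣S∣≤length-ys = subst (∣ fromList chosen ∣ ℕ.≤_) (sym (length-map (dsum W ∘ L′) chosen)) (∣fromList∣≤length chosen)
  size : (+ ∣ fromList chosen ∣ / 1) * η ≤ 1ℚ
  size = size*η≤1 ∣ fromList chosen ∣ η
    (ℤ.≤-trans (ℤ.*-monoʳ-≤-nonNeg (↥ η) {{ℤ.nonNegative 0≤↥η}} (ℤ.+≤+ ∣S∣≤length-ys)) length-bound)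
  cover′ : IsCover W C η ỹ L′ (fromList chosen) ((+ 2 / 1) * ζ)
  cover′ z z∈L =
    let j , _ , close = cover z z∈L
        l , l∈chosen , close′ = chosen-covers z j close
    in l , ∈fromList l∈chosen , subst (_< bias n (z ⊕ L′ l)) (sym (1-2[2ζ]≡ε+ε-1 ζ)) close′
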